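{- Let $n>2$ and $i>1$ be integers. Then \[\max_{x+y=i+1} F'(x,y)\;\le\;\max_{x+y=i} F'(x,y),\] where the maxima are over $(x,y)\in\mathbb{Z}^2$; i.e., the maximum element of row $i+1$ of the difference table is no greater than that of row $i$.
   Context: For a fixed integer $n\ge0$, define $F:\mathbb{Z}^2\to\mathbb{Z}_{\ge0}$ by $F(0,0)=2^n$, $F(x,y)=\lfloor F(x-1,y)/2\rfloor+\lfloor F(x,y-1)/2\rfloor$ for every $(x,y)\in\mathbb{Z}_{\ge0}^2\setminus\{(0,0)\}$, and $F(x,y)=0$ for $(x,y)$ outside the first quadrant (the intermediate firing configuration of chip-firing on the quadrant lattice graph started with $2^n$ chips at the origin). The difference table is $F'(x,y)=F(x-1,y)-F(x,y-1)$ for $(x,y)\in\mathbb{Z}^2$; row $i$ of the difference table consists of the entries $F'(x,y)$ with $x+y=i$ (only finitely many are nonzero). -}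

module Defs where

open import Data.Nat using (ℕ; zero; suc; _^_)
open import Data.Nat.DivMod using (_/_)
import Data.Nat as ℕ
open import Data.Integer using (ℤ; +_; -[1+_]; _-_)

-- Chip-firing intermediate configuration on the first quadrant, started with 2^n chips
-- at the origin:  F(0,0) = 2^n,  F(x,y) = ⌊F(x-1,y)/2⌋ + ⌊F(x,y-1)/2⌋ (terms outside the
-- quadrant being 0).
Fℕ : ℕ → ℕ → ℕ → ℕ
Fℕ n zero    zero    = 2 ^ n
Fℕ n (suc x) zero    = Fℕ n x zero / 2
Fℕ n zero    (suc y) = Fℕ n zero y / 2
Fℕ n (suc x) (suc y) = (Fℕ n x (suc y) / 2) ℕ.+ (Fℕ n (suc x) y / 2)

F : ℕ → ℤ → ℤ → ℕ
F n (+ x)    (+ y)    = Fℕ n x y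
F n (+ x)    -[1+ y ] = 0
F n -[1+ x ] _        = 0

F′ : ℕ → ℤ → ℤ → ℤ
F′ n x y = (+ F n (x - + 1) y) - (+ F n x (y - + 1))

{-# OPTIONS --safe #-}
-- For x + y = i + 1 with i ≥ 1, the recurrence applies at both (x - 1, y) and (x, y - 1);
-- writing a, b, c for F at (x - 2, y), (x - 1, y - 1), (x, y - 2), the shared term ⌊b/2⌋
-- cancels and F′(x,y) = ⌊a/2⌋ - ⌊c/2⌋, while F′(x - 1, y) = a - b and F′(x, y - 1) = b - c.
-- Twice ⌊a/2⌋ - ⌊c/2⌋ is at most (a - b) + (b - c) + 1, so the integer ⌊a/2⌋ - ⌊c/2⌋
-- cannot exceed both a - b and b - c.
module Submission where

open import Defs
open import Data.Nat using (ℕ; zero; suc)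
import Data.Nat as ℕ
import Data.Nat.Properties as ℕ
open import Data.Nat.DivMod using (_/_; _%_; m/n*n≤m; m≡m%n+[m/n]*n; m%n<n)
import Data.Nat.Tactic.RingSolver as ℕ-Solver
open import Data.Integer using (ℤ; +_; -[1+_]; _+_; _-_; -_; _≤_; _<_; +≤+; 1ℤ)
open import Data.Integer.Properties
  using ( _≤?_; ≰⇒>; <⇒≱; i<j⇒suc[i]≤j; +-mono-≤-<; +-monoˡ-≤; +-monoʳ-≤; neg-mono-≤
        ; module ≤-Reasoning)
open import Data.Integer.Tactic.RingSolver using (solve-∀)
open import Data.Product using (∃₂; _×_; _,_)
open import Data.Sum using (_⊎_; inj₁; inj₂)
open import Relation.Nullary using (yes; no; contradiction)
open import Relation.Binary.PropositionalEquality
  using (_≡_; refl; sym; trans; cong; cong₂; subst; module ≡-Reasoning)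

F-recurrence : ∀ n x y k → x + y ≡ + suc k →
  F n x y ≡ F n (x - 1ℤ) y / 2 ℕ.+ F n x (y - 1ℤ) / 2
F-recurrence n -[1+ x ]  y         k _  = refl
F-recurrence n (+ zero)  -[1+ y ]  k _  = refl
F-recurrence n (+ suc x) -[1+ y ]  k _  = refl
F-recurrence n (+ zero)  (+ zero)  k ()
F-recurrence n (+ suc x) (+ zero)  k _  = sym (ℕ.+-identityʳ _)
F-recurrence n (+ zero)  (+ suc y) k _  = refl
F-recurrence n (+ suc x) (+ suc y) k _  = refl

[m/2]+[m/2]≡[m/2]*2 : ∀ m → m / 2 ℕ.+ m / 2 ≡ m / 2 ℕ.* 2
[m/2]+[m/2]≡[m/2]*2 m = lemma (m / 2)
  where
  lemma : ∀ h → h ℕ.+ h ≡ h ℕ.* 2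
  lemma = ℕ-Solver.solve-∀

[m/2]+[m/2]≤m : ∀ m → m / 2 ℕ.+ m / 2 ℕ.≤ m
[m/2]+[m/2]≤m m = subst (ℕ._≤ m) (sym ([m/2]+[m/2]≡[m/2]*2 m)) (m/n*n≤m m 2)

m≤[m/2]+[m/2]+1 : ∀ m → m ℕ.≤ m / 2 ℕ.+ m / 2 ℕ.+ 1
m≤[m/2]+[m/2]+1 m = begin
  m                       ≡⟨ m≡m%n+[m/n]*n m 2 ⟩
  m % 2 ℕ.+ m / 2 ℕ.* 2   ≤⟨ ℕ.+-monoˡ-≤ (m / 2 ℕ.* 2) (ℕ.s≤s⁻¹ (m%n<n m 2)) ⟩
  1 ℕ.+ m / 2 ℕ.* 2       ≡⟨ ℕ.+-comm 1 _ ⟩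
  m / 2 ℕ.* 2 ℕ.+ 1       ≡⟨ cong (ℕ._+ 1) (sym ([m/2]+[m/2]≡[m/2]*2 m)) ⟩
  m / 2 ℕ.+ m / 2 ℕ.+ 1   ∎
  where open ℕ.≤-Reasoning

[i-k]+[i-k]≤j-l+1 : ∀ {i j k l} → i + i ≤ j → l ≤ k + k + 1ℤ →
  (i - k) + (i - k) ≤ (j - l) + 1ℤ
[i-k]+[i-k]≤j-l+1 {i} {j} {k} {l} i+i≤j l≤k+k+1 = begin
  (i - k) + (i - k)         ≡⟨ regroup i k ⟩
  (i + i) - (k + k)         ≤⟨ +-monoˡ-≤ (- (k + k)) i+i≤j ⟩
  j - (k + k)               ≡⟨ shift j k ⟩
  (j - (k + k + 1ℤ)) + 1ℤ   ≤⟨ +-monoˡ-≤ 1ℤ (+-monoʳ-≤ j (neg-mono-≤ l≤k+k+1)) ⟩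
  (j - l) + 1ℤ              ∎
  where
  open ≤-Reasoning
  regroup : ∀ i k → (i - k) + (i - k) ≡ (i + i) - (k + k)
  regroup = solve-∀
  shift : ∀ j k → j - (k + k) ≡ (j - (k + k + 1ℤ)) + 1ℤ
  shift = solve-∀

i+i≤j+k+1⇒i≤j⊎i≤k : ∀ i j k → i + i ≤ j + k + 1ℤ → i ≤ j ⊎ i ≤ k
i+i≤j+k+1⇒i≤j⊎i≤k i j k i+i≤j+k+1 with i ≤? j | i ≤? k
... | yes i≤j | _       = inj₁ i≤j
... | no  _   | yes i≤k = inj₂ i≤k
... | no  i≰j | no  i≰k = contradiction i+i≤j+k+1 (<⇒≱ j+k+1<i+i)
  where
  j+k+1<i+i : j + k + 1ℤ < i + i
  j+k+1<i+i = subst (_< i + i) (reorder j k) (+-mono-≤-< (i<j⇒suc[i]≤j (≰⇒> i≰j)) (≰⇒> i≰k))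
    where
    reorder : ∀ j k → (1ℤ + j) + k ≡ j + k + 1ℤ
    reorder = solve-∀

[a/2]-[c/2]≤a-b⊎b-c : ∀ a b c →
  + (a / 2) - + (c / 2) ≤ + a - + b ⊎ + (a / 2) - + (c / 2) ≤ + b - + c
[a/2]-[c/2]≤a-b⊎b-c a b c = i+i≤j+k+1⇒i≤j⊎i≤k (+ (a / 2) - + (c / 2)) (+ a - + b) (+ b - + c)
  (subst (_ ≤_) (telescope (+ a) (+ b) (+ c))
    ([i-k]+[i-k]≤j-l+1 {+ (a / 2)} {+ a} {+ (c / 2)} {+ c}
      (+≤+ ([m/2]+[m/2]≤m a)) (+≤+ (m≤[m/2]+[m/2]+1 c))))
  where
  telescope : ∀ a b c → (a - c) + 1ℤ ≡ (a - b) + (b - c) + 1ℤ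
  telescope = solve-∀

[x-1]+y≡k : ∀ x y k → x + y ≡ + suc k → (x - 1ℤ) + y ≡ + k
[x-1]+y≡k x y k x+y≡1+k = trans (reorder x y) (cong (_- 1ℤ) x+y≡1+k)
  where
  reorder : ∀ x y → (x - 1ℤ) + y ≡ (x + y) - 1ℤ
  reorder = solve-∀

x+[y-1]≡k : ∀ x y k → x + y ≡ + suc k → x + (y - 1ℤ) ≡ + k
x+[y-1]≡k x y k x+y≡1+k = trans (reorder x y) (cong (_- 1ℤ) x+y≡1+k)
  where
  reorder : ∀ x y → x + (y - 1ℤ) ≡ (x + y) - 1ℤ
  reorder = solve-∀

F′-recurrence : ∀ n x y k → x + y ≡ + suc (suc k) →
  F′ n x y ≡ + (F n ((x - 1ℤ) - 1ℤ) y / 2) - + (F n x ((y - 1ℤ) - 1ℤ) / 2)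
F′-recurrence n x y k x+y≡2+k = begin
  F′ n x y
    ≡⟨ cong₂ (λ u v → + u - + v)
         (F-recurrence n (x - 1ℤ) y k ([x-1]+y≡k x y _ x+y≡2+k))
         (F-recurrence n x (y - 1ℤ) k (x+[y-1]≡k x y _ x+y≡2+k)) ⟩
  (+ a/2 + + b/2) - (+ b/2 + + c/2)
    ≡⟨ cancel (+ a/2) (+ b/2) (+ c/2) ⟩
  + a/2 - + c/2
    ∎
  where
  open ≡-Reasoning
  a/2 b/2 c/2 : ℕ
  a/2 = F n ((x - 1ℤ) - 1ℤ) y / 2
  b/2 = F n (x - 1ℤ) (y - 1ℤ) / 2
  c/2 = F n x ((y - 1ℤ) - 1ℤ) / 2
  cancel : ∀ a b c → (a + b) - (b + c) ≡ a - c
  cancel = solve-∀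

F′-≤-F′-previous-row : ∀ n x y k → x + y ≡ + suc (suc k) →
  F′ n x y ≤ F′ n (x - 1ℤ) y ⊎ F′ n x y ≤ F′ n x (y - 1ℤ)
F′-≤-F′-previous-row n x y k x+y≡2+k =
  subst (λ d → d ≤ F′ n (x - 1ℤ) y ⊎ d ≤ F′ n x (y - 1ℤ)) (sym (F′-recurrence n x y k x+y≡2+k))
    ([a/2]-[c/2]≤a-b⊎b-c (F n ((x - 1ℤ) - 1ℤ) y) (F n (x - 1ℤ) (y - 1ℤ)) (F n x ((y - 1ℤ) - 1ℤ)))

-- The hypotheses 2 < n and 1 < i are stronger than needed: the argument only uses i ≠ 0.
proposition9p4 : (n i : ℕ) → 2 ℕ.< n → 1 ℕ.< i →
    (x y : ℤ) → x + y ≡ + (ℕ.suc i) →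
    ∃₂ λ (x′ y′ : ℤ) → (x′ + y′ ≡ + i) × (F′ n x y ≤ F′ n x′ y′)
proposition9p4 n zero    _ () x y _
proposition9p4 n (suc k) _ _  x y x+y≡2+k with F′-≤-F′-previous-row n x y k x+y≡2+k
... | inj₁ ≤left  = x - 1ℤ , y , [x-1]+y≡k x y _ x+y≡2+k , ≤left
... | inj₂ ≤below = x , y - 1ℤ , x+[y-1]≡k x y _ x+y≡2+k , ≤below
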